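{- Let $n\ge1$, let $k_0,k_1,\dots,k_n$ be non-negative integers and let $0\leq \tau_0\leq k_0$ be an integer. Then \[ P_q(k_0,k_1,\dots, k_n)=\sum_{\tau_1,\dots,\tau_n} P_q(\tau_0,\tau_1,\dots,\tau_n)\,P_q(k_0-\tau_0,k_1-\tau_1,\dots,k_n-\tau_n)\, q^{\sum_{i=0}^{n-1}\tau_i(k_{i+1}-\tau_{i+1})}, \] where the sum is over integers $\tau_1,\dots,\tau_n$ with $0\le\tau_i\le k_i$.
   Context: $P_q(k_0,\dots,k_n)=\prod_{m=1}^{n}\left[{k_{m-1}+k_m-1 \atop k_m}\right]_q$. Here, for integers $a$ and $b$, $\left[{a\atop b}\right]_q=\prod_{i=1}^{b}\frac{1-q^{a-i+1}}{1-q^i}$ if $b\ge0$ and $0$ if $b<0$; in particular $\left[{ -1\atop 0}\right]_q=1$ and $\left[{b-1\atop b}\right]_q=0$ for $b\ge1$. -}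

module Defs where

open import Data.Nat as ℕ using (ℕ; zero; suc)
open import Data.Integer as ℤ using (ℤ; +_; -[1+_])
open import Data.Rational using (ℚ; 0ℚ; 1ℚ; _*_; _+_; _-_; _÷_; ≢-nonZero)
open import Data.Rational.Properties using (_≟_)
open import Data.List using (List; []; _∷_; map; concatMap; zipWith)
open import Data.Vec using (Vec; toList)
open import Relation.Nullary using (yes; no)

_^ℕ_ : ℚ → ℕ → ℚ
q ^ℕ zero  = 1ℚ
q ^ℕ suc n = q * (q ^ℕ n)

-- division in ℚ, totalised by p ÷ 0 = 0 (only used where the divisor is nonzero)
_÷'_ : ℚ → ℚ → ℚ
p ÷' r with r ≟ 0ℚ
... | yes _  = 0ℚ
... | no r≢0 = _÷_ p r {{≢-nonZero r≢0}}

_^ℤ_ : ℚ → ℤ → ℚ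
q ^ℤ (+ n)     = q ^ℕ n
q ^ℤ -[1+ n ]  = 1ℚ ÷' (q ^ℕ suc n)

qbinProd : ℚ → ℤ → ℕ → ℚ
qbinProd q a zero    = 1ℚ
qbinProd q a (suc b) =
  qbinProd q a b * ((1ℚ - (q ^ℤ (a ℤ.- (+ suc b) ℤ.+ (+ 1)))) ÷' (1ℚ - (q ^ℕ suc b)))

-- Gaussian binomial [a atop b]_q, evaluated at q ∈ ℚ; 0 when b < 0
qbin : ℚ → ℤ → ℤ → ℚ
qbin q a (+ b)     = qbinProd q a b
qbin q a -[1+ _ ]  = 0ℚ

Pq : ℚ → List ℕ → ℚ
Pq q []            = 1ℚ
Pq q (_ ∷ [])      = 1ℚ
Pq q (a ∷ b ∷ ks)  = qbin q ((+ (a ℕ.+ b)) ℤ.- (+ 1)) (+ b) * Pq q (b ∷ ks)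

expo : List ℕ → List ℕ → ℕ
expo (t ∷ t' ∷ ts) (_ ∷ k' ∷ ks) = t ℕ.* (k' ℕ.∸ t') ℕ.+ expo (t' ∷ ts) (k' ∷ ks)
expo _ _ = 0

range : ℕ → List ℕ
range zero    = 0 ∷ []
range (suc k) = 0 ∷ map suc (range k)

box : List ℕ → List (List ℕ)
box []       = [] ∷ []
box (k ∷ ks) = concatMap (λ t → map (t ∷_) (box ks)) (range k)

sumℚ : List ℚ → ℚ
sumℚ []       = 0ℚ
sumℚ (x ∷ xs) = x + sumℚ xs

rhs : ℚ → ℕ → ℕ → List ℕ → ℚ
rhs q τ₀ k₀ ks = sumℚ (map term (box ks))
  where
  term : List ℕ → ℚ
  term τs = Pq q (τ₀ ∷ τs) * Pq q (zipWith ℕ._∸_ (k₀ ∷ ks) (τ₀ ∷ τs))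
            * (q ^ℕ expo (τ₀ ∷ τs) (k₀ ∷ ks))

module Submission where

-- Write M a t for the polynomial q-multichoose, defined by the q-Pascal
-- recurrence M (a+1) (t+1) = M a (t+1) + q^a M (a+1) t; it equals the
-- Gaussian binomial [a+t-1 atop t]_q.  The proof has three ingredients.
--   1. The product formula: for q ≠ ±1 (so that every 1 - q^(t+1) ≠ 0) the
--      product qbin of the statement agrees with M, via the ratio identity
--      M a (t+1) (1 - q^(t+1)) = M (a+1) t (1 - q^a).
--   2. The q-Vandermonde identity for multisets:
--      M (a+a') k = Σ_{t+s=k} M a t · M a' s · q^(a s).
--   3. Peeling the first summation variable τ₁ = t off the right-hand side:
--      each summand factors as [τ₀+t-1 atop t][k₀-τ₀+k₁-t-1 atop k₁-t] q^(τ₀(k₁-t))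
--      times a summand of the right-hand side for (t; k₁, …, kₙ).
-- The theorem follows by induction on the list (k₁, …, kₙ): expand the first
-- factor [k₀+k₁-1 atop k₁] of P_q with Vandermonde at k₀ = τ₀ + (k₀ - τ₀),
-- use the induction hypothesis for every t ≤ k₁, and reassemble with 3.

open import Defs
open import Data.Nat as ℕ using (ℕ; zero; suc; _≤_)
import Data.Nat.Properties as ℕP
open import Data.Integer as ℤ using () renaming (+_ to +ℤ_)
import Data.Integer.Properties as ℤP
import Data.Integer.Tactic.RingSolver as ℤRing
open import Data.Rational as Q using (ℚ; 0ℚ; 1ℚ; -_; _+_; _*_; _-_; ∣_∣; ≢-nonZero)
import Data.Rational.Properties as QP
open import Data.Rational.Solver using (module +-*-Solver)
open import Data.List using (List; []; _∷_; map; concatMap; zipWith; _++_)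
import Data.List.Properties as ListP
open import Data.Vec using (Vec; toList)
open import Data.Sum using (inj₁; inj₂)
open import Data.Empty using (⊥-elim)
open import Relation.Nullary using (yes; no)
open import Relation.Binary.Definitions using (tri<; tri≈; tri>)
open import Relation.Binary.PropositionalEquality
  using (_≡_; _≢_; refl; sym; trans; cong; cong₂; subst; module ≡-Reasoning)
open ≡-Reasoning
open +-*-Solver

^ℕ-+ : ∀ q m n → q ^ℕ (m ℕ.+ n) ≡ q ^ℕ m * q ^ℕ n
^ℕ-+ q zero    n = sym (QP.*-identityˡ (q ^ℕ n))
^ℕ-+ q (suc m) n = trans (cong (q *_) (^ℕ-+ q m n)) (sym (QP.*-assoc q (q ^ℕ m) (q ^ℕ n)))

∣^ℕ∣ : ∀ q n → ∣ q ^ℕ n ∣ ≡ ∣ q ∣ ^ℕ n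
∣^ℕ∣ q zero    = refl
∣^ℕ∣ q (suc n) = trans (QP.∣p*q∣≡∣p∣*∣q∣ q (q ^ℕ n)) (cong (∣ q ∣ *_) (∣^ℕ∣ q n))

^ℕ-<1 : ∀ r .{{_ : Q.NonNegative r}} → r Q.< 1ℚ → ∀ n → r ^ℕ suc n Q.< 1ℚ
^ℕ-<1 r r<1 zero    = subst (Q._< 1ℚ) (sym (QP.*-identityʳ r)) r<1
^ℕ-<1 r r<1 (suc n) = QP.≤-<-trans r*rⁿ≤r r<1
  where
  r*rⁿ≤r : r * r ^ℕ suc n Q.≤ r
  r*rⁿ≤r = subst (r * r ^ℕ suc n Q.≤_) (QP.*-identityʳ r)
                 (QP.*-monoˡ-≤-nonNeg r (QP.<⇒≤ (^ℕ-<1 r r<1 n)))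

^ℕ->1 : ∀ r → 1ℚ Q.< r → ∀ n → 1ℚ Q.< r ^ℕ suc n
^ℕ->1 r 1<r zero    = subst (1ℚ Q.<_) (sym (QP.*-identityʳ r)) 1<r
^ℕ->1 r 1<r (suc n) = QP.<-trans 1<r r<r*rⁿ
  where
  instance
    r-pos : Q.Positive r
    r-pos = Q.positive (QP.<-trans (QP.positive⁻¹ 1ℚ) 1<r)
  r<r*rⁿ : r Q.< r * r ^ℕ suc n
  r<r*rⁿ = subst (Q._< r * r ^ℕ suc n) (QP.*-identityʳ r) (QP.*-monoʳ-<-pos r (^ℕ->1 r 1<r n))

-- For q ≠ ±1 no positive power of ∣q∣ equals 1: compare ∣q∣ with 1.
∣q∣^suc≢1 : ∀ q → q ≢ 1ℚ → q ≢ - 1ℚ → ∀ n → ∣ q ∣ ^ℕ suc n ≢ 1ℚ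
∣q∣^suc≢1 q q≢1 q≢-1 n ∣q∣ⁿ≡1 with QP.<-cmp ∣ q ∣ 1ℚ
... | tri< ∣q∣<1 _ _ = QP.<-irrefl ∣q∣ⁿ≡1 (^ℕ-<1 ∣ q ∣ {{QP.∣-∣-nonNeg q}} ∣q∣<1 n)
... | tri> _ _ ∣q∣>1 = QP.<-irrefl (sym ∣q∣ⁿ≡1) (^ℕ->1 ∣ q ∣ ∣q∣>1 n)
... | tri≈ _ ∣q∣≡1 _ with QP.∣p∣≡p∨∣p∣≡-p q
...   | inj₁ ∣q∣≡q  = q≢1 (trans (sym ∣q∣≡q) ∣q∣≡1)
...   | inj₂ ∣q∣≡-q = q≢-1 (trans (solve 1 (λ x → x := :- (:- x)) refl q)
                                  (cong -_ (trans (sym ∣q∣≡-q) ∣q∣≡1)))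

1-q^suc≢0 : ∀ q → q ≢ 1ℚ → q ≢ - 1ℚ → ∀ n → 1ℚ - q ^ℕ suc n ≢ 0ℚ
1-q^suc≢0 q q≢1 q≢-1 n 1-qⁿ≡0 =
  ∣q∣^suc≢1 q q≢1 q≢-1 n (trans (sym (∣^ℕ∣ q (suc n))) (cong ∣_∣ qⁿ≡1))
  where
  qⁿ≡1 : q ^ℕ suc n ≡ 1ℚ
  qⁿ≡1 = trans (solve 1 (λ x → x := con 1ℚ :- (con 1ℚ :- x)) refl (q ^ℕ suc n))
               (cong (λ z → 1ℚ - z) 1-qⁿ≡0)

÷'-cancelʳ : ∀ x d → d ≢ 0ℚ → (x * d) ÷' d ≡ x
÷'-cancelʳ x d d≢0 with d Q.≟ 0ℚ
... | yes d≡0 = ⊥-elim (d≢0 d≡0)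
... | no d≢0' = trans (QP.*-assoc x d _)
                  (trans (cong (x *_) (QP.*-inverseʳ d {{≢-nonZero d≢0'}})) (QP.*-identityʳ x))

*-÷'-assoc : ∀ x y d → x * (y ÷' d) ≡ (x * y) ÷' d
*-÷'-assoc x y d with d Q.≟ 0ℚ
... | yes _ = QP.*-zeroʳ x
... | no _  = sym (QP.*-assoc x y _)

antidiagonal : (ℕ → ℕ → ℚ) → ℕ → ℚ
antidiagonal f zero    = f 0 0
antidiagonal f (suc k) = f 0 (suc k) + antidiagonal (λ t s → f (suc t) s) k

antidiagonal-cong : ∀ f g k → (∀ t s → f t s ≡ g t s) → antidiagonal f k ≡ antidiagonal g k
antidiagonal-cong f g zero    f≡g = f≡g 0 0
antidiagonal-cong f g (suc k) f≡g =
  cong₂ _+_ (f≡g 0 (suc k)) (antidiagonal-cong _ _ k (λ t s → f≡g (suc t) s))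

antidiagonal-+ : ∀ f g k →
  antidiagonal (λ t s → f t s + g t s) k ≡ antidiagonal f k + antidiagonal g k
antidiagonal-+ f g zero    = refl
antidiagonal-+ f g (suc k) = begin
  (a + b) + antidiagonal (λ t s → f (suc t) s + g (suc t) s) k
    ≡⟨ cong ((a + b) +_) (antidiagonal-+ _ _ k) ⟩
  (a + b) + (c + d)
    ≡⟨ solve 4 (λ a b c d → (a :+ b) :+ (c :+ d) := (a :+ c) :+ (b :+ d)) refl a b c d ⟩
  (a + c) + (b + d) ∎
  where
  a b c d : ℚ
  a = f 0 (suc k)
  b = g 0 (suc k)
  c = antidiagonal (λ t s → f (suc t) s) k
  d = antidiagonal (λ t s → g (suc t) s) k

antidiagonal-*ˡ : ∀ c f k → antidiagonal (λ t s → c * f t s) k ≡ c * antidiagonal f k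
antidiagonal-*ˡ c f zero    = refl
antidiagonal-*ˡ c f (suc k) =
  trans (cong (c * f 0 (suc k) +_) (antidiagonal-*ˡ c _ k))
        (sym (QP.*-distribˡ-+ c (f 0 (suc k)) (antidiagonal (λ t s → f (suc t) s) k)))

antidiagonal-*ʳ : ∀ f c k → antidiagonal (λ t s → f t s * c) k ≡ antidiagonal f k * c
antidiagonal-*ʳ f c zero    = refl
antidiagonal-*ʳ f c (suc k) =
  trans (cong (f 0 (suc k) * c +_) (antidiagonal-*ʳ _ c k))
        (sym (QP.*-distribʳ-+ c (f 0 (suc k)) (antidiagonal (λ t s → f (suc t) s) k)))

antidiagonal-last : ∀ f k →
  antidiagonal f (suc k) ≡ antidiagonal (λ t s → f t (suc s)) k + f (suc k) 0
antidiagonal-last f zero    = refl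
antidiagonal-last f (suc k) =
  trans (cong (f 0 (suc (suc k)) +_) (antidiagonal-last (λ t s → f (suc t) s) k))
        (sym (QP.+-assoc (f 0 (suc (suc k))) (antidiagonal (λ t s → f (suc t) (suc s)) k)
                         (f (suc (suc k)) 0)))

antidiagonal-zero : ∀ f k → (∀ t s → f t s ≡ 0ℚ) → antidiagonal f k ≡ 0ℚ
antidiagonal-zero f zero    f≡0 = f≡0 0 0
antidiagonal-zero f (suc k) f≡0 =
  trans (cong₂ _+_ (f≡0 0 (suc k)) (antidiagonal-zero _ k (λ t s → f≡0 (suc t) s)))
        (QP.+-identityʳ 0ℚ)

module _ (q : ℚ) where

  -- Generating polynomial of multisets of size t from a types, an element of
  -- type i (counting from 0) weighted q^i: type a is either absent or adds q^a.
  M : ℕ → ℕ → ℚ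
  M zero    zero    = 1ℚ
  M zero    (suc t) = 0ℚ
  M (suc a) zero    = 1ℚ
  M (suc a) (suc t) = M a (suc t) + q ^ℕ a * M (suc a) t

  M-zeroʳ : ∀ a → M a 0 ≡ 1ℚ
  M-zeroʳ zero    = refl
  M-zeroʳ (suc a) = refl

  -- Base case a' = 0 of Vandermonde: M 0 s vanishes except at s = 0.
  vandermonde-zeroʳ : ∀ a k →
    M a k ≡ antidiagonal (λ t s → M a t * M 0 s * q ^ℕ (a ℕ.* s)) k
  vandermonde-zeroʳ a zero rewrite ℕP.*-zeroʳ a | M-zeroʳ a = refl
  vandermonde-zeroʳ a (suc k) = sym (begin
    antidiagonal F (suc k)
      ≡⟨ antidiagonal-last F k ⟩
    antidiagonal (λ t s → F t (suc s)) k + F (suc k) 0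
      ≡⟨ cong (_+ F (suc k) 0) (antidiagonal-zero _ k F-shift≡0) ⟩
    0ℚ + F (suc k) 0
      ≡⟨ QP.+-identityˡ (F (suc k) 0) ⟩
    M a (suc k) * 1ℚ * q ^ℕ (a ℕ.* 0)
      ≡⟨ cong (λ e → M a (suc k) * 1ℚ * q ^ℕ e) (ℕP.*-zeroʳ a) ⟩
    M a (suc k) * 1ℚ * 1ℚ
      ≡⟨ trans (QP.*-identityʳ (M a (suc k) * 1ℚ)) (QP.*-identityʳ (M a (suc k))) ⟩
    M a (suc k) ∎)
    where
    F : ℕ → ℕ → ℚ
    F t s = M a t * M 0 s * q ^ℕ (a ℕ.* s)
    F-shift≡0 : ∀ t s → F t (suc s) ≡ 0ℚ
    F-shift≡0 t s = trans (cong (_* q ^ℕ (a ℕ.* suc s)) (QP.*-zeroʳ (M a t)))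
                          (QP.*-zeroˡ (q ^ℕ (a ℕ.* suc s)))

  -- q-Vandermonde for multisets: a multiset from a + a' types splits into t
  -- elements of the first a types and s of the last a', the latter each
  -- shifted by q^a.
  vandermonde : ∀ a a' k →
    M (a ℕ.+ a') k ≡ antidiagonal (λ t s → M a t * M a' s * q ^ℕ (a ℕ.* s)) k
  vandermonde a zero k rewrite ℕP.+-identityʳ a = vandermonde-zeroʳ a k
  vandermonde a (suc a') zero rewrite ℕP.*-zeroʳ a | M-zeroʳ a | M-zeroʳ (a ℕ.+ suc a') = refl
  vandermonde a (suc a') (suc k) rewrite ℕP.+-suc a a' = begin
    M (a ℕ.+ a') (suc k) + p * M (suc (a ℕ.+ a')) k
      ≡⟨ cong₂ (λ x y → x + p * y) (trans (vandermonde a a' (suc k)) (antidiagonal-last G k)) IH ⟩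
    (antidiagonal (λ t s → G t (suc s)) k + G (suc k) 0) + p * antidiagonal F k
      ≡⟨ cong (λ z → (antidiagonal (λ t s → G t (suc s)) k + z) + p * antidiagonal F k) last≡ ⟩
    (antidiagonal (λ t s → G t (suc s)) k + F (suc k) 0) + p * antidiagonal F k
      ≡⟨ solve 3 (λ x y z → (x :+ y) :+ z := (x :+ z) :+ y) refl
           (antidiagonal (λ t s → G t (suc s)) k) (F (suc k) 0) (p * antidiagonal F k) ⟩
    (antidiagonal (λ t s → G t (suc s)) k + p * antidiagonal F k) + F (suc k) 0
      ≡⟨ cong (_+ F (suc k) 0) (sym (trans (antidiagonal-+ _ _ k)
           (cong (antidiagonal (λ t s → G t (suc s)) k +_) (antidiagonal-*ˡ p F k)))) ⟩
    antidiagonal (λ t s → G t (suc s) + p * F t s) k + F (suc k) 0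
      ≡⟨ cong (_+ F (suc k) 0) (antidiagonal-cong _ _ k pascal) ⟩
    antidiagonal (λ t s → F t (suc s)) k + F (suc k) 0
      ≡⟨ sym (antidiagonal-last F k) ⟩
    antidiagonal F (suc k) ∎
    where
    p : ℚ
    p = q ^ℕ (a ℕ.+ a')
    F G : ℕ → ℕ → ℚ
    F t s = M a t * M (suc a') s * q ^ℕ (a ℕ.* s)
    G t s = M a t * M a' s * q ^ℕ (a ℕ.* s)
    IH : M (suc (a ℕ.+ a')) k ≡ antidiagonal F k
    IH = trans (cong (λ b → M b k) (sym (ℕP.+-suc a a'))) (vandermonde a (suc a') k)
    last≡ : G (suc k) 0 ≡ F (suc k) 0
    last≡ rewrite M-zeroʳ a' = refl
    -- the recurrence for M (a'+1) (s+1), multiplied through by M a t q^(a(s+1))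
    pascal : ∀ t s → G t (suc s) + p * F t s ≡ F t (suc s)
    pascal t s rewrite ℕP.*-suc a s | ^ℕ-+ q a (a ℕ.* s) | ^ℕ-+ q a a' =
      solve 6 (λ x y z u v w → x :* y :* (u :* v) :+ (u :* w) :* (x :* z :* v)
                             := x :* (y :+ w :* z) :* (u :* v)) refl
        (M a t) (M a' (suc s)) (M (suc a') s) (q ^ℕ a) (q ^ℕ (a ℕ.* s)) (q ^ℕ a')

  M-ratio : ∀ a t → M a (suc t) * (1ℚ - q ^ℕ suc t) ≡ M (suc a) t * (1ℚ - q ^ℕ a)
  M-ratio zero t =
    solve 2 (λ x y → con 0ℚ :* x := y :* (con 1ℚ :- con 1ℚ)) refl (1ℚ - q ^ℕ suc t) (M 1 t)
  M-ratio (suc a) zero = begin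
    (M a 1 + p * 1ℚ) * (1ℚ - q * 1ℚ)
      ≡⟨ solve 3 (λ x p q → (x :+ p :* con 1ℚ) :* (con 1ℚ :- q :* con 1ℚ)
                          := x :* (con 1ℚ :- q :* con 1ℚ) :+ p :* (con 1ℚ :- q)) refl (M a 1) p q ⟩
    M a 1 * (1ℚ - q * 1ℚ) + p * (1ℚ - q)
      ≡⟨ cong (_+ p * (1ℚ - q)) (trans (M-ratio a 0) (cong (_* (1ℚ - p)) (M-zeroʳ (suc a)))) ⟩
    1ℚ * (1ℚ - p) + p * (1ℚ - q)
      ≡⟨ solve 2 (λ p q → con 1ℚ :* (con 1ℚ :- p) :+ p :* (con 1ℚ :- q)
                        := con 1ℚ :* (con 1ℚ :- q :* p)) refl p q ⟩
    1ℚ * (1ℚ - q * p) ∎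
    where
    p : ℚ
    p = q ^ℕ a
  M-ratio (suc a) (suc t) = begin
    (Z + p * Y) * (1ℚ - q * r)
      ≡⟨ solve 5 (λ Z p Y q r → (Z :+ p :* Y) :* (con 1ℚ :- q :* r)
                              := Z :* (con 1ℚ :- q :* r) :+ p :* Y :* (con 1ℚ :- q :* r)) refl Z p Y q r ⟩
    Z * (1ℚ - q * r) + p * Y * (1ℚ - q * r)
      ≡⟨ cong (_+ p * Y * (1ℚ - q * r)) (M-ratio a (suc t)) ⟩
    Y * (1ℚ - p) + p * Y * (1ℚ - q * r)
      ≡⟨ solve 4 (λ Y p q r → Y :* (con 1ℚ :- p) :+ p :* Y :* (con 1ℚ :- q :* r)
                            := Y :* (con 1ℚ :- q :* p) :+ q :* p :* (Y :* (con 1ℚ :- r))) refl Y p q r ⟩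
    Y * (1ℚ - q * p) + q * p * (Y * (1ℚ - r))
      ≡⟨ cong (λ z → Y * (1ℚ - q * p) + q * p * z) (M-ratio (suc a) t) ⟩
    Y * (1ℚ - q * p) + q * p * (W * (1ℚ - q * p))
      ≡⟨ solve 4 (λ Y W q p → Y :* (con 1ℚ :- q :* p) :+ q :* p :* (W :* (con 1ℚ :- q :* p))
                            := (Y :+ q :* p :* W) :* (con 1ℚ :- q :* p)) refl Y W q p ⟩
    (Y + q * p * W) * (1ℚ - q * p) ∎
    where
    Z Y W p r : ℚ
    Z = M a (suc (suc t))
    Y = M (suc a) (suc t)
    W = M (suc (suc a)) t
    p = q ^ℕ a
    r = q ^ℕ suc t

gauss : ℚ → ℕ → ℕ → ℚ
gauss q a b = qbin q (+ℤ (a ℕ.+ b) ℤ.- +ℤ 1) (+ℤ b)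

-- The exponent (a + t + 1) - 1 - (t + 1) + 1 of the last factor of qbinProd.
last-exponent : ∀ a t → (+ℤ (a ℕ.+ suc t) ℤ.- +ℤ 1) ℤ.- (+ℤ suc t) ℤ.+ (+ℤ 1) ≡ +ℤ a
last-exponent a t rewrite ℤP.pos-+ a (suc t) = cancel (+ℤ a) (+ℤ suc t)
  where
  cancel : ∀ x y → ((x ℤ.+ y) ℤ.- +ℤ 1) ℤ.- y ℤ.+ +ℤ 1 ≡ x
  cancel = ℤRing.solve-∀

-- Induction on t, peeling the last factor and cancelling it with M-ratio.
gauss≡M : ∀ q → q ≢ 1ℚ → q ≢ - 1ℚ → ∀ a t → gauss q a t ≡ M q a t
gauss≡M q q≢1 q≢-1 a zero    = sym (M-zeroʳ q a)
gauss≡M q q≢1 q≢-1 a (suc t) = begin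
  qbinProd q A t * ((1ℚ - q ^ℤ (A ℤ.- +ℤ suc t ℤ.+ +ℤ 1)) ÷' d)
    ≡⟨ cong₂ (λ x e → x * ((1ℚ - q ^ℤ e) ÷' d)) IH (last-exponent a t) ⟩
  M q (suc a) t * ((1ℚ - q ^ℕ a) ÷' d)
    ≡⟨ *-÷'-assoc (M q (suc a) t) (1ℚ - q ^ℕ a) d ⟩
  (M q (suc a) t * (1ℚ - q ^ℕ a)) ÷' d
    ≡⟨ cong (_÷' d) (sym (M-ratio q a t)) ⟩
  (M q a (suc t) * d) ÷' d
    ≡⟨ ÷'-cancelʳ (M q a (suc t)) d (1-q^suc≢0 q q≢1 q≢-1 t) ⟩
  M q a (suc t) ∎
  where
  A : ℤ.ℤ
  A = +ℤ (a ℕ.+ suc t) ℤ.- +ℤ 1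
  d : ℚ
  d = 1ℚ - q ^ℕ suc t
  IH : qbinProd q A t ≡ M q (suc a) t
  IH = trans (cong (λ N → qbinProd q (+ℤ N ℤ.- +ℤ 1) t) (ℕP.+-suc a t)) (gauss≡M q q≢1 q≢-1 (suc a) t)

sumℚ-++ : ∀ {A : Set} (f : A → ℚ) xs ys →
  sumℚ (map f (xs ++ ys)) ≡ sumℚ (map f xs) + sumℚ (map f ys)
sumℚ-++ f []       ys = sym (QP.+-identityˡ (sumℚ (map f ys)))
sumℚ-++ f (x ∷ xs) ys =
  trans (cong (f x +_) (sumℚ-++ f xs ys)) (sym (QP.+-assoc (f x) (sumℚ (map f xs)) (sumℚ (map f ys))))

sumℚ-concatMap : ∀ {A B : Set} (f : B → ℚ) (g : A → List B) xs →
  sumℚ (map f (concatMap g xs)) ≡ sumℚ (map (λ x → sumℚ (map f (g x))) xs)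
sumℚ-concatMap f g []       = refl
sumℚ-concatMap f g (x ∷ xs) =
  trans (sumℚ-++ f (g x) (concatMap g xs)) (cong (sumℚ (map f (g x)) +_) (sumℚ-concatMap f g xs))

sumℚ-cong : ∀ {A : Set} (f g : A → ℚ) xs → (∀ x → f x ≡ g x) → sumℚ (map f xs) ≡ sumℚ (map g xs)
sumℚ-cong f g []       f≡g = refl
sumℚ-cong f g (x ∷ xs) f≡g = cong₂ _+_ (f≡g x) (sumℚ-cong f g xs f≡g)

sumℚ-*ˡ : ∀ {A : Set} c (f : A → ℚ) xs → sumℚ (map (λ x → c * f x) xs) ≡ c * sumℚ (map f xs)
sumℚ-*ˡ c f []       = sym (QP.*-zeroʳ c)
sumℚ-*ˡ c f (x ∷ xs) =
  trans (cong (c * f x +_) (sumℚ-*ˡ c f xs)) (sym (QP.*-distribˡ-+ c (f x) (sumℚ (map f xs))))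

sumℚ-range : ∀ k (h : ℕ → ℚ) F → (∀ t s → t ℕ.+ s ≡ k → h t ≡ F t s) →
  sumℚ (map h (range k)) ≡ antidiagonal F k
sumℚ-range zero    h F h≡F = trans (QP.+-identityʳ (h 0)) (h≡F 0 0 refl)
sumℚ-range (suc k) h F h≡F = cong₂ _+_ (h≡F 0 (suc k) refl) (begin
  sumℚ (map h (map suc (range k)))
    ≡⟨ cong sumℚ (sym (ListP.map-∘ (range k))) ⟩
  sumℚ (map (λ t → h (suc t)) (range k))
    ≡⟨ sumℚ-range k _ _ (λ t s t+s≡k → h≡F (suc t) s (cong suc t+s≡k)) ⟩
  antidiagonal (λ t s → F (suc t) s) k ∎)

summand : ℚ → ℕ → ℕ → List ℕ → List ℕ → ℚ
summand q τ₀ k₀ ks τs = Pq q (τ₀ ∷ τs) * Pq q (zipWith ℕ._∸_ (k₀ ∷ ks) (τ₀ ∷ τs))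
                        * (q ^ℕ expo (τ₀ ∷ τs) (k₀ ∷ ks))

-- The factor of the summand involving only τ₀ and τ₁ = t, with s = k₁ - t.
weight : ℚ → ℕ → ℕ → ℕ → ℕ → ℚ
weight q τ₀ k₀ t s = gauss q τ₀ t * gauss q (k₀ ℕ.∸ τ₀) s * q ^ℕ (τ₀ ℕ.* s)

summand-cons : ∀ q τ₀ k₀ k₁ ks t τs →
  summand q τ₀ k₀ (k₁ ∷ ks) (t ∷ τs) ≡ weight q τ₀ k₀ t (k₁ ℕ.∸ t) * summand q t k₁ ks τs
summand-cons q τ₀ k₀ k₁ ks t τs rewrite ^ℕ-+ q (τ₀ ℕ.* (k₁ ℕ.∸ t)) (expo (t ∷ τs) (k₁ ∷ ks)) =
  solve 6 (λ b₁ p₁ b₂ p₂ e₁ e₂ → b₁ :* p₁ :* (b₂ :* p₂) :* (e₁ :* e₂)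
                                := b₁ :* b₂ :* e₁ :* (p₁ :* p₂ :* e₂)) refl
    (gauss q τ₀ t) (Pq q (t ∷ τs))
    (gauss q (k₀ ℕ.∸ τ₀) (k₁ ℕ.∸ t)) (Pq q (zipWith ℕ._∸_ (k₁ ∷ ks) (t ∷ τs)))
    (q ^ℕ (τ₀ ℕ.* (k₁ ℕ.∸ t))) (q ^ℕ expo (t ∷ τs) (k₁ ∷ ks))

rhs-cons : ∀ q τ₀ k₀ k₁ ks →
  rhs q τ₀ k₀ (k₁ ∷ ks) ≡ sumℚ (map (λ t → weight q τ₀ k₀ t (k₁ ℕ.∸ t) * rhs q t k₁ ks) (range k₁))
rhs-cons q τ₀ k₀ k₁ ks = begin
  sumℚ (map f (concatMap (λ t → map (t ∷_) (box ks)) (range k₁)))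
    ≡⟨ sumℚ-concatMap f (λ t → map (t ∷_) (box ks)) (range k₁) ⟩
  sumℚ (map (λ t → sumℚ (map f (map (t ∷_) (box ks)))) (range k₁))
    ≡⟨ sumℚ-cong _ _ (range k₁) block ⟩
  sumℚ (map (λ t → weight q τ₀ k₀ t (k₁ ℕ.∸ t) * rhs q t k₁ ks) (range k₁)) ∎
  where
  f : List ℕ → ℚ
  f = summand q τ₀ k₀ (k₁ ∷ ks)
  block : ∀ t → sumℚ (map f (map (t ∷_) (box ks))) ≡ weight q τ₀ k₀ t (k₁ ℕ.∸ t) * rhs q t k₁ ks
  block t = begin
    sumℚ (map f (map (t ∷_) (box ks)))
      ≡⟨ cong sumℚ (sym (ListP.map-∘ (box ks))) ⟩
    sumℚ (map (λ τs → f (t ∷ τs)) (box ks))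
      ≡⟨ sumℚ-cong _ _ (box ks) (summand-cons q τ₀ k₀ k₁ ks t) ⟩
    sumℚ (map (λ τs → weight q τ₀ k₀ t (k₁ ℕ.∸ t) * summand q t k₁ ks τs) (box ks))
      ≡⟨ sumℚ-*ˡ (weight q τ₀ k₀ t (k₁ ℕ.∸ t)) (summand q t k₁ ks) (box ks) ⟩
    weight q τ₀ k₀ t (k₁ ℕ.∸ t) * rhs q t k₁ ks ∎

module _ (q : ℚ) (q≢1 : q ≢ 1ℚ) (q≢-1 : q ≢ - 1ℚ) where

  splitting : ∀ ks k₀ τ₀ → τ₀ ≤ k₀ → Pq q (k₀ ∷ ks) ≡ rhs q τ₀ k₀ ks
  splitting []        k₀ τ₀ _      = refl
  splitting (k₁ ∷ ks) k₀ τ₀ τ₀≤k₀ = begin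
    gauss q k₀ k₁ * Pk
      ≡⟨ cong (_* Pk) (gauss≡M q q≢1 q≢-1 k₀ k₁) ⟩
    M q k₀ k₁ * Pk
      ≡⟨ cong (λ a → M q a k₁ * Pk) (sym (ℕP.m+[n∸m]≡n τ₀≤k₀)) ⟩
    M q (τ₀ ℕ.+ (k₀ ℕ.∸ τ₀)) k₁ * Pk
      ≡⟨ cong (_* Pk) (vandermonde q τ₀ (k₀ ℕ.∸ τ₀) k₁) ⟩
    antidiagonal G k₁ * Pk
      ≡⟨ sym (antidiagonal-*ʳ G Pk k₁) ⟩
    antidiagonal (λ t s → G t s * Pk) k₁
      ≡⟨ sym (sumℚ-range k₁ _ _ term≡) ⟩
    sumℚ (map (λ t → weight q τ₀ k₀ t (k₁ ℕ.∸ t) * rhs q t k₁ ks) (range k₁))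
      ≡⟨ sym (rhs-cons q τ₀ k₀ k₁ ks) ⟩
    rhs q τ₀ k₀ (k₁ ∷ ks) ∎
    where
    Pk : ℚ
    Pk = Pq q (k₁ ∷ ks)
    G : ℕ → ℕ → ℚ
    G t s = M q τ₀ t * M q (k₀ ℕ.∸ τ₀) s * q ^ℕ (τ₀ ℕ.* s)
    term≡ : ∀ t s → t ℕ.+ s ≡ k₁ → weight q τ₀ k₀ t (k₁ ℕ.∸ t) * rhs q t k₁ ks ≡ G t s * Pk
    term≡ t s t+s≡k₁ = cong₂ _*_ weight≡G (sym (splitting ks k₁ t t≤k₁))
      where
      t≤k₁ : t ≤ k₁
      t≤k₁ = subst (t ≤_) t+s≡k₁ (ℕP.m≤m+n t s)
      k₁∸t≡s : k₁ ℕ.∸ t ≡ s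
      k₁∸t≡s = trans (cong (ℕ._∸ t) (sym t+s≡k₁)) (ℕP.m+n∸m≡n t s)
      weight≡G : weight q τ₀ k₀ t (k₁ ℕ.∸ t) ≡ G t s
      weight≡G rewrite k₁∸t≡s = cong₂ (λ x y → x * y * q ^ℕ (τ₀ ℕ.* s))
        (gauss≡M q q≢1 q≢-1 τ₀ t) (gauss≡M q q≢1 q≢-1 (k₀ ℕ.∸ τ₀) s)

theorem4p2 : (q : ℚ) → q ≢ 1ℚ → q ≢ - 1ℚ →
    (n : ℕ) → 1 ≤ n → (k₀ : ℕ) (ks : Vec ℕ n) (τ₀ : ℕ) → τ₀ ≤ k₀ →
    Pq q (k₀ ∷ toList ks) ≡ rhs q τ₀ k₀ (toList ks)
theorem4p2 q q≢1 q≢-1 n _ k₀ ks τ₀ τ₀≤k₀ = splitting q q≢1 q≢-1 (toList ks) k₀ τ₀ τ₀≤k₀
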